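{- Let $k\geq 2$ be an integer and let $G=(V,E)$ be a graph with girth at least $2k+1$. Then for all $v\in V$, $$\sum_{w\in N_1(v)}d_{k-1}(w)\leq d_k(v)+d_1(v)\,d_{k-2}(v).$$
   Context: $N_i(v)$ is the set of vertices at hop distance exactly $i$ from $v$, and $d_i(v)=|N_i(v)|$ (so $N_0(v)=\{v\}$, $d_0(v)=1$, and $d_1(v)$ is the degree). -}

module Defs where

open import Data.Nat using (ℕ; zero; suc; _+_; _*_; _≤_; _<_)
open import Data.Nat.Base using (_≡ᵇ_)
open import Data.Bool using (Bool; true; false; _∧_; _∨_; not; if_then_else_)
open import Data.Fin using (Fin; toℕ)
open import Data.List using (List; map; allFin; upTo)
open import Data.Bool.ListAction using (any)
open import Data.Nat.ListAction using (sum)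
open import Data.Sum using (_⊎_)
open import Data.Product using (_×_)
open import Function.Definitions using (Injective)
open import Relation.Binary.PropositionalEquality using (_≡_)

record Graph (n : ℕ) : Set where
  field
    adj   : Fin n → Fin n → Bool
    sym   : ∀ u w → adj u w ≡ adj w u
    irrefl : ∀ u → adj u u ≡ false

module _ {n : ℕ} (G : Graph n) where
  open Graph G

  _==_ : Fin n → Fin n → Bool
  u == w = toℕ u ≡ᵇ toℕ w

  walk : ℕ → Fin n → Fin n → Bool
  walk zero    u w = u == w
  walk (suc ℓ) u w = any (λ x → adj u x ∧ walk ℓ x w) (allFin n)

  distIs : ℕ → Fin n → Fin n → Bool
  distIs i u w = walk i u w ∧ not (any (λ j → walk j u w) (upTo i))

  Σv : (Fin n → ℕ) → ℕ
  Σv f = sum (map f (allFin n))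

  d : ℕ → Fin n → ℕ
  d i v = Σv (λ w → if distIs i v w then 1 else 0)

  ΣN₁ : Fin n → (Fin n → ℕ) → ℕ
  ΣN₁ v f = Σv (λ w → if distIs 1 v w then f w else 0)

  record Cycle (m : ℕ) : Set where
    field
      three : 3 ≤ m
      c     : Fin m → Fin n
      inj   : Injective _≡_ _≡_ c
      edges : ∀ (i j : Fin m) →
              (suc (toℕ i) ≡ toℕ j ⊎ (suc (toℕ i) ≡ m × toℕ j ≡ 0)) →
              adj (c i) (c j) ≡ true

  GirthAtLeast : ℕ → Set
  GirthAtLeast g = ∀ m → Cycle m → g ≤ m

module Submission where

-- For k = r + 2, count the pairs (w, x) with w a neighbour of v and
-- d(w, x) = r + 1.  Grouped by w this is the left-hand side.  Grouped by x:
-- d(v, x) ∈ {r, r+1, r+2} since distances change by at most one along an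
-- edge; d(v, x) = r+1 would close an odd cycle of length ≤ 2r+3 = 2k-1;
-- if d(v, x) = r+2 two such neighbours w would close an even cycle of length
-- ≤ 2k; if d(v, x) = r there are at most d₁(v) such w.  This gives
-- Σ_x ([d(v,x) = k] + d₁(v)·[d(v,x) = k-2]) = d_k(v) + d₁(v)·d_{k-2}(v).

open import Defs
open import Data.Nat using (ℕ; zero; suc; _+_; _*_; _≤_; _<_; _∸_; z≤n; s≤s; s≤s⁻¹)
open import Data.Nat.Properties
open import Data.Nat.Induction using (<-rec)
open import Data.Nat.ListAction using (sum)
open import Data.Bool using (Bool; true; false; T; _∧_; not; if_then_else_)
open import Data.Bool.Properties using (T-∧; T-≡)
open import Data.Bool.ListAction using (any)
open import Data.Fin using (Fin; toℕ)
open import Data.Fin.Properties using (toℕ-injective; toℕ<n) renaming (_≟_ to _≟ᶠ_)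
open import Data.List using (List; []; _∷_; map; allFin; upTo)
open import Data.List.Properties using (map-cong)
open import Data.List.Relation.Unary.All as All using ()
open import Data.List.Relation.Unary.AllPairs using (_∷_)
open import Data.List.Relation.Unary.Any using (here; there)
open import Data.List.Relation.Unary.Any.Properties using (any⁺; any⁻)
open import Data.List.Relation.Unary.Unique.Propositional using (Unique)
open import Data.List.Relation.Unary.Unique.Propositional.Properties using (allFin⁺)
open import Data.List.Membership.Propositional using (_∈_; lose; find)
open import Data.List.Membership.Propositional.Properties using (∈-upTo⁺; ∈-upTo⁻; ∈-allFin)
open import Data.Product using (∃; _×_; _,_; proj₁; proj₂)
open import Data.Sum using (_⊎_; inj₁; inj₂)
open import Data.Empty using (⊥; ⊥-elim)
open import Function using (_∘_; Equivalence)
open import Relation.Nullary using (¬_; Dec; yes; no; contradiction)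
open import Relation.Nullary.Decidable using (map′; T?)
open import Relation.Binary.PropositionalEquality
open import Algebra.Properties.CommutativeSemigroup +-commutativeSemigroup using (interchange)

open Equivalence using (to; from)

module _ {A : Set} where

  sum-mono : (f g : A → ℕ) (xs : List A) → (∀ x → f x ≤ g x) →
             sum (map f xs) ≤ sum (map g xs)
  sum-mono f g []       f≤g = z≤n
  sum-mono f g (x ∷ xs) f≤g = +-mono-≤ (f≤g x) (sum-mono f g xs f≤g)

  sum-zero : (f : A → ℕ) (xs : List A) → (∀ {x} → x ∈ xs → f x ≡ 0) →
             sum (map f xs) ≡ 0
  sum-zero f []       f≡0 = refl
  sum-zero f (x ∷ xs) f≡0 =
    cong₂ _+_ (f≡0 (here refl)) (sum-zero f xs (f≡0 ∘ there))

  sum-+ : (f g : A → ℕ) (xs : List A) →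
          sum (map (λ x → f x + g x) xs) ≡ sum (map f xs) + sum (map g xs)
  sum-+ f g []       = refl
  sum-+ f g (x ∷ xs) = begin
    (f x + g x) + sum (map (λ x → f x + g x) xs)
      ≡⟨ cong ((f x + g x) +_) (sum-+ f g xs) ⟩
    (f x + g x) + (sum (map f xs) + sum (map g xs))
      ≡⟨ interchange (f x) (g x) _ _ ⟩
    (f x + sum (map f xs)) + (g x + sum (map g xs)) ∎
    where open ≡-Reasoning

  sum-scale : (c : ℕ) (f : A → ℕ) (xs : List A) →
              sum (map (λ x → c * f x) xs) ≡ c * sum (map f xs)
  sum-scale c f []       = sym (*-zeroʳ c)
  sum-scale c f (x ∷ xs) =
    trans (cong (c * f x +_) (sum-scale c f xs)) (sym (*-distribˡ-+ c (f x) _))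

sum-swap : {A B : Set} (g : A → B → ℕ) (xs : List A) (ys : List B) →
           sum (map (λ a → sum (map (g a) ys)) xs) ≡
           sum (map (λ b → sum (map (λ a → g a b) xs)) ys)
sum-swap g []       ys = sym (sum-zero (λ _ → 0) ys (λ _ → refl))
sum-swap g (x ∷ xs) ys =
  trans (cong (sum (map (g x) ys) +_) (sum-swap g xs ys))
        (sym (sum-+ (g x) (λ b → sum (map (λ a → g a b) xs)) ys))

indicator : Bool → ℕ
indicator b = if b then 1 else 0

indicator-false : ∀ {b} → ¬ T b → indicator b ≡ 0
indicator-false {true}  ¬b = contradiction _ ¬b
indicator-false {false} _  = refl

indicator-∧ : ∀ a b → indicator (a ∧ b) ≤ indicator a
indicator-∧ true  b = indicator-≤1 b
  where
  indicator-≤1 : ∀ b → indicator b ≤ 1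
  indicator-≤1 true  = ≤-refl
  indicator-≤1 false = z≤n
indicator-∧ false b = z≤n

count-atMostOne : {A : Set} (p : A → Bool) (xs : List A) → Unique xs →
                  (∀ {a b} → T (p a) → T (p b) → a ≡ b) →
                  sum (map (indicator ∘ p) xs) ≤ 1
count-atMostOne p []       _            unique = z≤n
count-atMostOne p (x ∷ xs) (x∉xs ∷ xs!) unique with T? (p x)
... | no ¬px = subst (_≤ 1) (cong (_+ _) (sym (indicator-false ¬px)))
                     (count-atMostOne p xs xs! unique)
... | yes px = ≤-reflexive (cong₂ _+_ (indicator-true px) (sum-zero _ xs others))
  where
  indicator-true : ∀ {b} → T b → indicator b ≡ 1
  indicator-true {true} _ = refl
  others : ∀ {y} → y ∈ xs → indicator (p y) ≡ 0
  others y∈xs = indicator-false (λ py → All.lookup x∉xs y∈xs (unique px py))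

join : {A : Set} → ℕ → (ℕ → A) → (ℕ → A) → ℕ → A
join s f g j with j ≤? s
... | yes _ = f j
... | no  _ = g j

module _ {A : Set} (s : ℕ) (f g : ℕ → A) where

  join-≤ : ∀ {j} → j ≤ s → join s f g j ≡ f j
  join-≤ {j} j≤s with j ≤? s
  ... | yes _   = refl
  ... | no  j≰s = contradiction j≤s j≰s

  join-> : ∀ {j} → s < j → join s f g j ≡ g j
  join-> {j} s<j with j ≤? s
  ... | yes j≤s = contradiction j≤s (<⇒≱ s<j)
  ... | no  _   = refl

not-intro : ∀ {b} → ¬ T b → T (not b)
not-intro {false} _  = _
not-intro {true}  ¬b = ¬b _

not-elim : ∀ {b} → T (not b) → ¬ T b
not-elim {false} _ ()

module GraphTheory {n : ℕ} (G : Graph n) where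
  open Graph G using (adj; irrefl) renaming (sym to adj-sym)

  _~_ : Fin n → Fin n → Set
  u ~ w = adj u w ≡ true

  ~-sym : ∀ {u w} → u ~ w → w ~ u
  ~-sym {u} {w} u~w = trans (adj-sym w u) u~w

  ~-irrefl : ∀ {u} → ¬ (u ~ u)
  ~-irrefl {u} u~u with trans (sym (irrefl u)) u~u
  ... | ()

  data Walk : ℕ → Fin n → Fin n → Set where
    []  : ∀ {u} → Walk 0 u u
    _∷_ : ∀ {ℓ u x w} → u ~ x → Walk ℓ x w → Walk (suc ℓ) u w

  walk-sound : ∀ ℓ {u w} → T (walk G ℓ u w) → Walk ℓ u w
  walk-sound zero    {u} {w} same with toℕ-injective (≡ᵇ⇒≡ (toℕ u) (toℕ w) same)
  ... | refl = []
  walk-sound (suc ℓ) {u} {w} some with find (any⁻ _ (allFin n) some)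
  ... | x , _ , step with to T-∧ step
  ...   | u~x , rest = to T-≡ u~x ∷ walk-sound ℓ rest

  walk-complete : ∀ {ℓ u w} → Walk ℓ u w → T (walk G ℓ u w)
  walk-complete {u = u} [] = ≡⇒≡ᵇ (toℕ u) (toℕ u) refl
  walk-complete (_∷_ {x = x} u~x rest) =
    any⁺ _ (lose (∈-allFin x) (from T-∧ (from T-≡ u~x , walk-complete rest)))

  _++_ : ∀ {p q u y w} → Walk p u y → Walk q y w → Walk (p + q) u w
  []           ++ rest = rest
  (u~x ∷ walk) ++ rest = u~x ∷ (walk ++ rest)

  record Dist (i : ℕ) (u w : Fin n) : Set where
    field
      shortest : Walk i u w
      minimal  : ∀ {j} → j < i → ¬ Walk j u w
  open Dist

  dist-sound : ∀ {i u w} → T (distIs G i u w) → Dist i u w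
  dist-sound {i} isDist with to T-∧ isDist
  ... | long , none = record
    { shortest = walk-sound i long
    ; minimal  = λ j<i short → not-elim none (any⁺ _ (lose (∈-upTo⁺ j<i) (walk-complete short)))
    }

  dist-complete : ∀ {i u w} → Dist i u w → T (distIs G i u w)
  dist-complete {i} {u} {w} dist = from T-∧ (walk-complete (shortest dist) , not-intro none)
    where
    none : ¬ T (any (λ j → walk G j u w) (upTo i))
    none some with find (any⁻ _ (upTo i) some)
    ... | j , j∈ , short = minimal dist (∈-upTo⁻ j∈) (walk-sound j short)

  walk? : ∀ ℓ u w → Dec (Walk ℓ u w)
  walk? ℓ u w = map′ (walk-sound ℓ) walk-complete (T? (walk G ℓ u w))

  dist-≤ : ∀ {i j u w} → Dist i u w → Walk j u w → i ≤ j
  dist-≤ dist other = ≮⇒≥ (λ j<i → minimal dist j<i other)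

  dist-unique : ∀ {i j u w} → Dist i u w → Dist j u w → i ≡ j
  dist-unique d₁ d₂ = ≤-antisym (dist-≤ d₁ (shortest d₂)) (dist-≤ d₂ (shortest d₁))

  walk⇒dist : ∀ j {u w} → Walk j u w → ∃ λ i → i ≤ j × Dist i u w
  walk⇒dist = <-rec (λ j → ∀ {u w} → Walk j u w → ∃ λ i → i ≤ j × Dist i u w) shorten
    where
    shorten : ∀ j → (∀ {i} → i < j → ∀ {u w} → Walk i u w → ∃ λ l → l ≤ i × Dist l u w) →
              ∀ {u w} → Walk j u w → ∃ λ i → i ≤ j × Dist i u w
    shorten j rec {u} {w} long with anyUpTo? (λ i → walk? i u w) j
    ... | no none = j , ≤-refl ,
                    record { shortest = long ; minimal = λ i<j short → none (_ , i<j , short) }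
    ... | yes (i , i<j , short) with rec i<j short
    ...   | l , l≤i , dist = l , ≤-trans l≤i (<⇒≤ i<j) , dist

  dist-split : ∀ {j t u y x} → Dist (j + t) u x → Walk j u y → Walk t y x →
               Dist j u y × Dist t y x
  dist-split {j} {t} dist first second =
    record { shortest = first
           ; minimal  = λ j′<j short → <⇒≱ (+-monoˡ-< t j′<j) (dist-≤ dist (short ++ second)) } ,
    record { shortest = second
           ; minimal  = λ t′<t short → <⇒≱ (+-monoʳ-< j t′<t) (dist-≤ dist (first ++ short)) }

  dist-zero⁻ : ∀ {u w} → Dist 0 u w → u ≡ w
  dist-zero⁻ dist with shortest dist
  ... | [] = refl

  dist-one⁻ : ∀ {u w} → Dist 1 u w → u ~ w
  dist-one⁻ dist with shortest dist
  ... | u~w ∷ [] = u~w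

  dist-adjacent : ∀ {r u w x} → u ~ w → Dist (suc r) w x →
                  Dist r u x ⊎ Dist (suc r) u x ⊎ Dist (suc (suc r)) u x
  dist-adjacent {r} u~w dist-w with walk⇒dist _ (u~w ∷ shortest dist-w)
  ... | i , i≤r+2 , dist-u with m≤n⇒m<n∨m≡n i≤r+2
  ...   | inj₂ refl = inj₂ (inj₂ dist-u)
  ...   | inj₁ (s≤s i≤r+1) with m≤n⇒m<n∨m≡n i≤r+1
  ...     | inj₂ refl = inj₂ (inj₁ dist-u)
  ...     | inj₁ (s≤s i≤r) with ≤-antisym i≤r (s≤s⁻¹ (dist-≤ dist-w (~-sym u~w ∷ shortest dist-u)))
  ...       | refl = inj₁ dist-u

  -- The vertex reached after i steps along a walk (its end once i ≥ length).
  along : ∀ {ℓ u w} → Walk ℓ u w → ℕ → Fin n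
  along {u = u} []         _       = u
  along {u = u} (_ ∷ _)    zero    = u
  along         (_ ∷ rest) (suc i) = along rest i

  along-start : ∀ {ℓ u w} (walk : Walk ℓ u w) → along walk 0 ≡ u
  along-start []      = refl
  along-start (_ ∷ _) = refl

  along-end : ∀ {ℓ u w} (walk : Walk ℓ u w) → along walk ℓ ≡ w
  along-end []         = refl
  along-end (_ ∷ rest) = along-end rest

  along-edge : ∀ {ℓ u w} (walk : Walk ℓ u w) {i} → i < ℓ → along walk i ~ along walk (suc i)
  along-edge (u~x ∷ rest) {zero}  _         = subst (_ ~_) (sym (along-start rest)) u~x
  along-edge (_   ∷ rest) {suc i} (s≤s i<ℓ) = along-edge rest i<ℓ

  along-backward : ∀ {ℓ u w} (walk : Walk ℓ u w) {t} → suc t ≤ ℓ →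
                   along walk (ℓ ∸ suc t) ~ along walk (ℓ ∸ t)
  along-backward {ℓ} walk {t} t<ℓ =
    subst (λ i → along walk (ℓ ∸ suc t) ~ along walk i) next
          (along-edge walk (subst (_≤ ℓ) (sym next) (m∸n≤m ℓ t)))
    where
    next : suc (ℓ ∸ suc t) ≡ ℓ ∸ t
    next = sym (+-∸-assoc 1 t<ℓ)

  along-split : ∀ {ℓ u w} (walk : Walk ℓ u w) {i} → i ≤ ℓ →
                Walk i u (along walk i) × Walk (ℓ ∸ i) (along walk i) w
  along-split []           z≤n = [] , []
  along-split (u~x ∷ rest) {zero}  _ = [] , u~x ∷ rest
  along-split (u~x ∷ rest) {suc i} (s≤s i≤ℓ) with along-split rest i≤ℓ
  ... | first , second = u~x ∷ first , second

  along-shortest : ∀ {s a x} (dist : Dist s a x) {i} → i ≤ s →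
                   Dist i a (along (shortest dist) i) × Dist (s ∸ i) (along (shortest dist) i) x
  along-shortest {s} {a} {x} dist {i} i≤s with along-split (shortest dist) i≤s
  ... | first , second =
    dist-split (subst (λ ℓ → Dist ℓ a x) (sym (m+[n∸m]≡n i≤s)) dist) first second

  -- A lowest meeting point of a and b below x: shortest walks a ⇝ apex and
  -- b ⇝ apex of equal length `height` that never occupy the same vertex at
  -- the same time before the apex, which lies `depth` steps above x.
  record Meeting (s : ℕ) (a b x : Fin n) : Set where
    field
      height depth : ℕ
      apex         : Fin n
      heights      : height + depth ≡ s
      descent      : Walk depth apex x
      fromA        : Dist height a apex
      fromB        : Dist height b apex
      apart        : ∀ {i} → i < height →
                     along (shortest fromA) i ≢ along (shortest fromB) i

  -- Two vertices at equal distance s from x meet "for the first time" at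
  -- some apex: if shortest walks to x collide early, recurse on the collision.
  meeting : ∀ s {a b x} → Dist s a x → Dist s b x → Meeting s a b x
  meeting = <-rec (λ s → ∀ {a b x} → Dist s a x → Dist s b x → Meeting s a b x) lowest
    where
    lowest : ∀ s → (∀ {i} → i < s → ∀ {a b y} → Dist i a y → Dist i b y → Meeting i a b y) →
             ∀ {a b x} → Dist s a x → Dist s b x → Meeting s a b x
    lowest s rec {a} {b} {x} dist-a dist-b
      with anyUpTo? (λ i → along (shortest dist-a) i ≟ᶠ along (shortest dist-b) i) s
    ... | no never = record
      { height = s ; depth = 0 ; apex = x ; heights = +-identityʳ s ; descent = []
      ; fromA = dist-a ; fromB = dist-b ; apart = λ i<s same → never (_ , i<s , same) }
    ... | yes (i , i<s , same) = record
      { height = height ; depth = depth + (s ∸ i) ; apex = apex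
      ; heights = begin
          height + (depth + (s ∸ i)) ≡⟨ +-assoc height depth (s ∸ i) ⟨
          height + depth + (s ∸ i)   ≡⟨ cong (_+ (s ∸ i)) heights ⟩
          i + (s ∸ i)                ≡⟨ m+[n∸m]≡n (<⇒≤ i<s) ⟩
          s                          ∎
      ; descent = descent ++ shortest (proj₂ (along-shortest dist-a (<⇒≤ i<s)))
      ; fromA = fromA ; fromB = fromB ; apart = apart }
      where
      open ≡-Reasoning
      earlier : Meeting i a b (along (shortest dist-a) i)
      earlier = rec i<s (proj₁ (along-shortest dist-a (<⇒≤ i<s)))
                  (subst (Dist i b) (sym same) (proj₁ (along-shortest dist-b (<⇒≤ i<s))))
      open Meeting earlier

  height-positive : ∀ {s a b x} → a ≢ b → (m : Meeting s a b x) → 1 ≤ Meeting.height m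
  height-positive a≢b m with Meeting.height m | Meeting.fromA m | Meeting.fromB m
  ... | zero  | dist-a | dist-b = contradiction (trans (dist-zero⁻ dist-a) (sym (dist-zero⁻ dist-b))) a≢b
  ... | suc _ | _      | _      = s≤s z≤n

  record IsPath (L : ℕ) (f : ℕ → Fin n) : Set where
    field
      distinct : ∀ {i j} → i ≤ L → j ≤ L → f i ≡ f j → i ≡ j
      linked   : ∀ {i} → i < L → f i ~ f (suc i)
  open IsPath

  close : ∀ {L f} → IsPath L f → 2 ≤ L → f L ~ f 0 → Cycle G (suc L)
  close {L} {f} path 2≤L closing = record
    { three = s≤s 2≤L
    ; c     = f ∘ toℕ
    ; inj   = λ {i} {j} same → toℕ-injective (distinct path (position i) (position j) same)
    ; edges = edge
    }
    where
    position : (i : Fin (suc L)) → toℕ i ≤ L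
    position i = s≤s⁻¹ (toℕ<n i)
    edge : ∀ i j → suc (toℕ i) ≡ toℕ j ⊎ (suc (toℕ i) ≡ suc L × toℕ j ≡ 0) →
           f (toℕ i) ~ f (toℕ j)
    edge i j (inj₁ next) =
      subst (λ t → f (toℕ i) ~ f t) next (linked path (subst (_≤ L) (sym next) (position j)))
    edge i j (inj₂ (last , first)) =
      subst₂ (λ t t′ → f t ~ f t′) (sym (suc-injective last)) (sym first) closing

  extend : ∀ {L f u} → IsPath L f → (∀ {j} → j ≤ L → f j ≢ u) → f L ~ u →
           IsPath (suc L) (join L f (λ _ → u))
  extend {L} {f} {u} path fresh f[L]~u = record { distinct = distinct′ ; linked = linked′ }
    where
    g : ℕ → Fin n
    g = join L f (λ _ → u)
    top : g (suc L) ≡ u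
    top = join-> L f (λ _ → u) ≤-refl
    position : ∀ {i} → i ≤ suc L → i ≤ L ⊎ i ≡ suc L
    position i≤ with m≤n⇒m<n∨m≡n i≤
    ... | inj₁ (s≤s i≤L) = inj₁ i≤L
    ... | inj₂ i≡        = inj₂ i≡
    distinct′ : ∀ {i j} → i ≤ suc L → j ≤ suc L → g i ≡ g j → i ≡ j
    distinct′ i≤ j≤ same with position i≤ | position j≤
    ... | inj₁ i≤L  | inj₁ j≤L  =
      distinct path i≤L j≤L (trans (sym (join-≤ L f _ i≤L)) (trans same (join-≤ L f _ j≤L)))
    ... | inj₁ i≤L  | inj₂ refl = ⊥-elim (fresh i≤L (trans (sym (join-≤ L f _ i≤L)) (trans same top)))
    ... | inj₂ refl | inj₁ j≤L  = ⊥-elim (fresh j≤L (trans (sym (join-≤ L f _ j≤L)) (trans (sym same) top)))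
    ... | inj₂ refl | inj₂ refl = refl
    linked′ : ∀ {i} → i < suc L → g i ~ g (suc i)
    linked′ (s≤s i≤L) with m≤n⇒m<n∨m≡n i≤L
    ... | inj₁ i<L  = subst₂ _~_ (sym (join-≤ L f _ i≤L)) (sym (join-≤ L f _ i<L)) (linked path i<L)
    ... | inj₂ refl = subst₂ _~_ (sym (join-≤ L f _ i≤L)) (sym top) f[L]~u

  -- Gluing a shortest walk a ⇝ x to the reverse of a shortest walk b ⇝ x of
  -- the same length s, when they never meet before x, gives a path of
  -- length 2s from a to b whose j-th vertex is at distance |s - j| from x.
  module Gluing {s a b x} (dist-a : Dist s a x) (dist-b : Dist s b x)
    (apart : ∀ {i} → i < s → along (shortest dist-a) i ≢ along (shortest dist-b) i) where

    private
      p q : ℕ → Fin n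
      p = along (shortest dist-a)
      q = along (shortest dist-b)

    glued : ℕ → Fin n
    glued = join s p (λ j → q (s ∸ (j ∸ s)))

    glued-first : ∀ {j} → j ≤ s → glued j ≡ p j
    glued-first = join-≤ s p _

    glued-second : ∀ {j} → s ≤ j → glued j ≡ q (s ∸ (j ∸ s))
    glued-second s≤j with m≤n⇒m<n∨m≡n s≤j
    ... | inj₁ s<j  = join-> s p _ s<j
    ... | inj₂ refl = begin
      glued s           ≡⟨ glued-first ≤-refl ⟩
      p s               ≡⟨ along-end (shortest dist-a) ⟩
      x                 ≡⟨ along-end (shortest dist-b) ⟨
      q s               ≡⟨ cong (λ t → q (s ∸ t)) (n∸n≡0 s) ⟨
      q (s ∸ (s ∸ s))   ∎
      where open ≡-Reasoning

    level-first : ∀ {j} → j ≤ s → Dist (s ∸ j) (glued j) x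
    level-first j≤s =
      subst (λ v → Dist _ v x) (sym (glued-first j≤s)) (proj₂ (along-shortest dist-a j≤s))

    level-second : ∀ {j} → s ≤ j → j ≤ s + s → Dist (j ∸ s) (glued j) x
    level-second {j} s≤j j≤2s =
      subst₂ (λ l v → Dist l v x) (m∸[m∸n]≡n t≤s) (sym (glued-second s≤j))
             (proj₂ (along-shortest dist-b (m∸n≤m s (j ∸ s))))
      where
      t≤s : j ∸ s ≤ s
      t≤s = m≤n+o⇒m∸n≤o j s j≤2s

    glued-start : glued 0 ≡ a
    glued-start = trans (glued-first z≤n) (along-start (shortest dist-a))

    glued-end : glued (s + s) ≡ b
    glued-end = begin
      glued (s + s)             ≡⟨ glued-second (m≤m+n s s) ⟩
      q (s ∸ ((s + s) ∸ s))     ≡⟨ cong (λ t → q (s ∸ t)) (m+n∸m≡n s s) ⟩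
      q (s ∸ s)                 ≡⟨ cong q (n∸n≡0 s) ⟩
      q 0                       ≡⟨ along-start (shortest dist-b) ⟩
      b                         ∎
      where open ≡-Reasoning

    glued-near : ∀ {j} → j ≤ s + s → ∃ λ l → l ≤ s × Dist l (glued j) x
    glued-near {j} j≤2s with ≤-total j s
    ... | inj₁ j≤s = s ∸ j , m∸n≤m s j , level-first j≤s
    ... | inj₂ s≤j = j ∸ s , m≤n+o⇒m∸n≤o j s j≤2s , level-second s≤j j≤2s

    private
      same-level : ∀ {i j l l′} → glued i ≡ glued j →
                   Dist l (glued i) x → Dist l′ (glued j) x → l ≡ l′
      same-level same dist-i dist-j = dist-unique dist-i (subst (λ v → Dist _ v x) (sym same) dist-j)

      crossing : ∀ {i j} → i ≤ s → s < j → j ≤ s + s → glued i ≢ glued j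
      crossing {i} {j} i≤s s<j j≤2s same = apart i<s (begin
        p i                  ≡⟨ glued-first i≤s ⟨
        glued i              ≡⟨ same ⟩
        glued j              ≡⟨ glued-second (<⇒≤ s<j) ⟩
        q (s ∸ (j ∸ s))      ≡⟨ cong q mirror ⟩
        q i                  ∎)
        where
        open ≡-Reasoning
        levels : s ∸ i ≡ j ∸ s
        levels = same-level {i} {j} same (level-first i≤s) (level-second (<⇒≤ s<j) j≤2s)
        mirror : s ∸ (j ∸ s) ≡ i
        mirror = trans (cong (s ∸_) (sym levels)) (m∸[m∸n]≡n i≤s)
        i<s : i < s
        i<s = m∸n≢0⇒n<m (λ s∸i≡0 → <⇒≢ (m<n⇒0<n∸m s<j) (sym (trans (sym levels) s∸i≡0)))

    glued-path : IsPath (s + s) glued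
    glued-path = record { distinct = distinct′ ; linked = linked′ }
      where
      distinct′ : ∀ {i j} → i ≤ s + s → j ≤ s + s → glued i ≡ glued j → i ≡ j
      distinct′ {i} {j} i≤2s j≤2s same with ≤-<-connex i s | ≤-<-connex j s
      ... | inj₁ i≤s | inj₁ j≤s =
        ∸-cancelˡ-≡ i≤s j≤s (same-level {i} {j} same (level-first i≤s) (level-first j≤s))
      ... | inj₂ s<i | inj₂ s<j =
        ∸-cancelʳ-≡ (<⇒≤ s<i) (<⇒≤ s<j)
          (same-level {i} {j} same (level-second (<⇒≤ s<i) i≤2s) (level-second (<⇒≤ s<j) j≤2s))
      ... | inj₁ i≤s | inj₂ s<j = contradiction same (crossing i≤s s<j j≤2s)
      ... | inj₂ s<i | inj₁ j≤s = contradiction (sym same) (crossing j≤s s<i i≤2s)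

      linked′ : ∀ {j} → j < s + s → glued j ~ glued (suc j)
      linked′ {j} j<2s with <-≤-connex j s
      ... | inj₁ j<s = subst₂ _~_ (sym (glued-first (<⇒≤ j<s))) (sym (glued-first j<s))
                             (along-edge (shortest dist-a) j<s)
      ... | inj₂ s≤j = subst₂ _~_ (sym (glued-second s≤j))
                             (sym (trans (glued-second (m≤n⇒m≤1+n s≤j)) (cong (λ t → q (s ∸ t)) next)))
                             (~-sym (along-backward (shortest dist-b) t<s))
        where
        next : suc j ∸ s ≡ suc (j ∸ s)
        next = +-∸-assoc 1 s≤j
        t<s : suc (j ∸ s) ≤ s
        t<s = subst (_≤ s) next (m≤n+o⇒m∸n≤o (suc j) s j<2s)

  module HighGirth (k : ℕ) (girth : GirthAtLeast G (2 * k + 1)) where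

    no-short-cycle : ∀ {m} → Cycle G m → m ≤ 2 * k → ⊥
    no-short-cycle {m} cycle m≤2k = m+1+n≰m (2 * k) (≤-trans (girth m cycle) m≤2k)

    private
      double : ∀ {h} → h < k → suc h + suc h ≤ 2 * k
      double {h} h<k = subst (suc h + suc h ≤_) (cong (k +_) (sym (+-identityʳ k))) (+-mono-≤ h<k h<k)

      below-k : ∀ {s a b x} (m : Meeting s a b x) → s < k → Meeting.height m < k
      below-k m s<k = ≤-<-trans (subst (height ≤_) heights (m≤m+n height depth)) s<k
        where open Meeting m

    -- No odd cycle of length ≤ 2s+1: adjacent vertices are never equidistant
    -- (at distance s < k) from a third vertex.
    equidistant-neighbours : ∀ {s a b x} → a ~ b → Dist s a x → Dist s b x → s < k → ⊥
    equidistant-neighbours {s} {a} {b} {x} a~b dist-a dist-b s<k =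
      no-short-cycle cycle (≤-trans (s≤s (+-monoʳ-≤ height (n≤1+n height))) (double (below-k m s<k)))
      where
      m : Meeting s a b x
      m = meeting s dist-a dist-b
      open Meeting m
      open Gluing fromA fromB apart
      h≥1 : 1 ≤ height
      h≥1 = height-positive (λ a≡b → ~-irrefl (subst (a ~_) (sym a≡b) a~b)) m
      cycle : Cycle G (suc (height + height))
      cycle = close glued-path (+-mono-≤ h≥1 h≥1)
                (subst₂ _~_ (sym glued-end) (sym glued-start) (~-sym a~b))

    -- No even cycle of length ≤ 2s+2: a vertex u at distance s+1 < k+1 from x
    -- has a unique neighbour at distance s from x.
    unique-parent : ∀ {s u a b x} → u ~ a → u ~ b → Dist s a x → Dist s b x →
                    Dist (suc s) u x → s < k → a ≡ b
    unique-parent {s} {u} {a} {b} {x} u~a u~b dist-a dist-b dist-u s<k with a ≟ᶠ b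
    ... | yes a≡b = a≡b
    ... | no  a≢b = ⊥-elim (no-short-cycle cycle
          (≤-trans (≤-reflexive (cong suc (sym (+-suc height height)))) (double (below-k m s<k))))
      where
      m : Meeting s a b x
      m = meeting s dist-a dist-b
      open Meeting m
      open Gluing fromA fromB apart
      h≥1 : 1 ≤ height
      h≥1 = height-positive a≢b m
      u-level : Dist (suc height) u apex
      u-level = proj₁ (dist-split (subst (λ ℓ → Dist ℓ u x) (cong suc (sym heights)) dist-u)
                                  (u~a ∷ shortest fromA) descent)
      u-fresh : ∀ {j} → j ≤ height + height → glued j ≢ u
      u-fresh j≤ same with glued-near j≤
      ... | l , l≤h , dist-j =
        1+n≰n (subst (_≤ height) (dist-unique (subst (λ v → Dist l v apex) same dist-j) u-level) l≤h)
      extended : ℕ → Fin n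
      extended = join (height + height) glued (λ _ → u)
      path : IsPath (suc (height + height)) extended
      path = extend glued-path u-fresh (subst (_~ u) (sym glued-end) (~-sym u~b))
      cycle : Cycle G (suc (suc (height + height)))
      cycle = close path (s≤s (≤-trans h≥1 (m≤m+n height height)))
                (subst₂ _~_ (sym (join-> (height + height) glued (λ _ → u) ≤-refl))
                            (sym (trans (join-≤ (height + height) glued (λ _ → u) z≤n) glued-start))
                            u~a)

  module Counting (r : ℕ) (girth : GirthAtLeast G (2 * suc (suc r) + 1)) (v : Fin n) where
    open HighGirth (suc (suc r)) girth

    link : Fin n → Fin n → Bool
    link w x = distIs G 1 v w ∧ distIs G (suc r) w x

    link-elim : ∀ {w x} → T (link w x) → v ~ w × Dist (suc r) w x
    link-elim linked with to T-∧ linked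
    ... | v-w , w-x = dist-one⁻ (dist-sound v-w) , dist-sound w-x

    row : ∀ w → (if distIs G 1 v w then d G (suc r) w else 0) ≡ Σv G (λ x → indicator (link w x))
    row w with distIs G 1 v w
    ... | true  = refl
    ... | false = sym (sum-zero _ (allFin n) (λ _ → refl))

    -- A vertex x receives at most one link if d(v,x) = r+2, at most d_1(v)
    -- links if d(v,x) = r, and none otherwise (d(v,x) = r+1 is impossible).
    column : ∀ x → Σv G (λ w → indicator (link w x)) ≤
                   indicator (distIs G (suc (suc r)) v x) + d G 1 v * indicator (distIs G r v x)
    column x with distIs G (suc (suc r)) v x in far
    ... | true = ≤-trans (count-atMostOne (λ w → link w x) (allFin n) (allFin⁺ n) one-parent) (m≤m+n 1 _)
      where
      one-parent : ∀ {w w′} → T (link w x) → T (link w′ x) → w ≡ w′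
      one-parent l l′ with link-elim l | link-elim l′
      ... | v~w , w-x | v~w′ , w′-x =
        unique-parent v~w v~w′ w-x w′-x (dist-sound (subst T (sym far) _)) ≤-refl
    ... | false with distIs G r v x in near
    ...   | true  = subst (Σv G (λ w → indicator (link w x)) ≤_) (sym (*-identityʳ (d G 1 v)))
                      (sum-mono (λ w → indicator (link w x)) (λ w → indicator (distIs G 1 v w)) (allFin n)
                                (λ w → indicator-∧ (distIs G 1 v w) _))
    ...   | false = ≤-reflexive (trans (sum-zero _ (allFin n) (λ _ → indicator-false no-link))
                                       (sym (*-zeroʳ (d G 1 v))))
      where
      no-link : ∀ {w} → ¬ T (link w x)
      no-link l with link-elim l
      ... | v~w , w-x with dist-adjacent v~w w-x
      ...   | inj₁ v-x        = subst T near (dist-complete v-x)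
      ...   | inj₂ (inj₁ v-x) = equidistant-neighbours v~w v-x w-x ≤-refl
      ...   | inj₂ (inj₂ v-x) = subst T far (dist-complete v-x)

lemma4 : (k : ℕ) → 2 ≤ k → (n : ℕ) → (G : Graph n) → GirthAtLeast G (2 * k + 1) → (v : Fin n) → ΣN₁ G v (d G (k ∸ 1)) ≤ d G k v + d G 1 v * d G (k ∸ 2) v
lemma4 (suc (suc r)) (s≤s (s≤s z≤n)) n G girth v = begin
  ΣN₁ G v (d G (suc r))
    ≡⟨ cong sum (map-cong row (allFin n)) ⟩
  Σv G (λ w → Σv G (λ x → indicator (link w x)))
    ≡⟨ sum-swap (λ w x → indicator (link w x)) (allFin n) (allFin n) ⟩
  Σv G (λ x → Σv G (λ w → indicator (link w x)))
    ≤⟨ sum-mono _ _ (allFin n) column ⟩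
  Σv G (λ x → indicator (distIs G k v x) + d₁ * indicator (distIs G r v x))
    ≡⟨ sum-+ _ _ (allFin n) ⟩
  d G k v + Σv G (λ x → d₁ * indicator (distIs G r v x))
    ≡⟨ cong (d G k v +_) (sum-scale d₁ _ (allFin n)) ⟩
  d G k v + d₁ * d G r v ∎
  where
  open ≤-Reasoning
  open GraphTheory.Counting G r girth v
  k : ℕ
  k = suc (suc r)
  d₁ : ℕ
  d₁ = d G 1 v
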